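{- Let $n$ be a positive integer, and let $\mathcal{M}_{\bar 0}(G_n)$ be the set of perfect matchings $M$ of $G_n$ with $u_0v_0\notin M$. Then $$\sum_{M\in\mathcal{M}_{\bar 0}(G_n)}x^{af(G_n,M)}=x\,Af(G_{n-1},x).$$
   Context: For a positive integer $n$, $G_n$ is the plane graph (a polyomino graph with $4n$ unit square faces) with vertex set $\{u_0,v_0\}\cup\{u_i,v_i,w_i,z_i: 1\le i\le 2n\}$, drawn with $w_i$ at $(i,3)$, $u_i$ at $(i,2)$, $v_i$ at $(i,1)$, $z_i$ at $(i,0)$ (and $u_0$ at $(0,2)$, $v_0$ at $(0,1)$), and edge set consisting of: $u_{i-1}u_i$ and $v_{i-1}v_i$ for $1\le i\le 2n$; $u_iv_i$ for $0\le i\le 2n$; $w_iu_i$ and $v_iz_i$ for $1\le i\le 2n$; $w_{2j-1}w_{2j}$ and $z_{2j-1}z_{2j}$ for $1\le j\le n$. $G_0$ is the null graph. For a perfect matching $M$ of a graph $G$, a set $S'\subseteq E(G)\setminus M$ is an anti-forcing set of $M$ if $G-S'$ has a unique perfect matching (namely $M$); the anti-forcing number $af(G,M)$ is the minimum size of an anti-forcing set of $M$. The anti-forcing polynomial is $Af(G,x)=\sum_M x^{af(G,M)}$ over all perfect matchings $M$ of $G$; for the null graph it equals $1$. -}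

module Defs where

open import Data.Bool using (Bool; true; false; if_then_else_)
open import Data.Nat using (ℕ; zero; suc; _+_; _*_; _≤_; _≟_; _≤?_)
open import Data.Fin using (Fin; toℕ)
open import Data.Fin.Subset using (Subset; inside; outside; _∈_; _∉_; _⊆_; _∩_; ∁; ∣_∣)
open import Data.Fin.Subset.Properties using (_⊆?_; anySubset?; _∈?_)
import Data.Fin.Properties as FinP
open import Data.List using (List; []; _∷_; _++_; length; lookup; upTo; concatMap)
open import Data.Product using (_×_; _,_; ∃; ∃-syntax; proj₁; proj₂)
open import Data.Sum using (_⊎_; inj₁; inj₂)
open import Data.Vec using ([]; _∷_; tabulate)
import Data.Vec.Properties as VecP
import Data.Bool.Properties as BoolP
open import Relation.Nullary using (Dec; yes; no; ¬_; does)
open import Relation.Nullary.Decidable using (_×-dec_; _⊎-dec_; ¬?; decidable-stable)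
open import Relation.Unary using (Pred; Decidable)
import Agda.Primitive
open import Relation.Binary.PropositionalEquality using (_≡_; refl)

-- Finite graphs: vertices are Fin V (identified with the labels 0..V-1),
-- edges are an explicit list of pairs of vertex labels.

record Graph : Set where
  field
    V     : ℕ
    edges : List (ℕ × ℕ)

open Graph public

nE : Graph → ℕ
nE G = length (edges G)

EdgeSet : Graph → Set
EdgeSet G = Subset (nE G)

Incident : ℕ → ℕ × ℕ → Set
Incident x (a , b) = (x ≡ a) ⊎ (x ≡ b)

incident? : (x : ℕ) (e : ℕ × ℕ) → Dec (Incident x e)
incident? x (a , b) = (x ≟ a) ⊎-dec (x ≟ b)

incidentEdges : (G : Graph) → Fin (V G) → EdgeSet G
incidentEdges G v =
  tabulate (λ e → if does (incident? (toℕ v) (lookup (edges G) e)) then inside else outside)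

IsPerfectMatching : (G : Graph) → EdgeSet G → Set
IsPerfectMatching G M = (v : Fin (V G)) → ∣ M ∩ incidentEdges G v ∣ ≡ 1

-- S' ⊆ E(G) \ M is an anti-forcing set of M: the perfect matchings of G - S'
-- (= perfect matchings of G using no edge of S') consist of M only.
-- (M itself is a perfect matching of G - S' since S' ∩ M = ∅.)
IsAntiForcingSet : (G : Graph) → EdgeSet G → EdgeSet G → Set
IsAntiForcingSet G M S =
  (S ⊆ ∁ M) × ((N : EdgeSet G) → IsPerfectMatching G N → N ⊆ ∁ S → N ≡ M)

AntiForcingNumberIs : (G : Graph) → EdgeSet G → ℕ → Set
AntiForcingNumberIs G M k =
  (∃[ S ] (IsAntiForcingSet G M S × ∣ S ∣ ≡ k)) ×
  ((S : EdgeSet G) → IsAntiForcingSet G M S → k ≤ ∣ S ∣)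

allSubset? : ∀ {n} {P : Pred (Subset n) Agda.Primitive.lzero} → Decidable P → Dec ((S : Subset n) → P S)
allSubset? {n} {P} P? with anySubset? (λ S → ¬? (P? S))
... | yes (S , ¬PS) = no (λ all → ¬PS (all S))
... | no ¬∃ = yes (λ S → decidable-stable (P? S) (λ ¬PS → ¬∃ (S , ¬PS)))

isPerfectMatching? : (G : Graph) → Decidable (IsPerfectMatching G)
isPerfectMatching? G M = FinP.all? (λ v → ∣ M ∩ incidentEdges G v ∣ ≟ 1)

subsetEq? : ∀ {n} (A B : Subset n) → Dec (A ≡ B)
subsetEq? = VecP.≡-dec BoolP._≟_

isAntiForcingSet? : (G : Graph) (M : EdgeSet G) → Decidable (IsAntiForcingSet G M)
isAntiForcingSet? G M S =
  (S ⊆? ∁ M) ×-dec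
  allSubset? (λ N → impl (isPerfectMatching? G N) (impl (N ⊆? ∁ S) (subsetEq? N M)))
  where
    impl : ∀ {A B : Set} → Dec A → Dec B → Dec (A → B)
    impl (yes a) (yes b) = yes (λ _ → b)
    impl (yes a) (no ¬b) = no (λ f → ¬b (f a))
    impl (no ¬a) _       = yes (λ a → Data.Empty.⊥-elim (¬a a))
      where import Data.Empty

antiForcingNumberIs? : (G : Graph) (M : EdgeSet G) (k : ℕ) → Dec (AntiForcingNumberIs G M k)
antiForcingNumberIs? G M k =
  anySubset? (λ S → isAntiForcingSet? G M S ×-dec (∣ S ∣ ≟ k)) ×-dec
  allSubset? (λ S → impl (isAntiForcingSet? G M S) (k ≤? ∣ S ∣))
  where
    impl : ∀ {A B : Set} → Dec A → Dec B → Dec (A → B)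
    impl (yes a) (yes b) = yes (λ _ → b)
    impl (yes a) (no ¬b) = no (λ f → ¬b (f a))
    impl (no ¬a) _       = yes (λ a → Data.Empty.⊥-elim (¬a a))
      where import Data.Empty

countSubsets : ∀ {n} {P : Pred (Subset n) Agda.Primitive.lzero} → Decidable P → ℕ
countSubsets {zero}  P? = if does (P? []) then 1 else 0
countSubsets {suc n} P? =
  countSubsets (λ S → P? (inside ∷ S)) + countSubsets (λ S → P? (outside ∷ S))

-- Polynomials with ℕ coefficients, as coefficient sequences (finitely supported
-- in all uses below); two polynomials are equal iff all coefficients agree.

Poly : Set
Poly = ℕ → ℕ

x* : Poly → Poly
x* p zero    = 0
x* p (suc k) = p k

Af : Graph → Poly
Af G k = countSubsets (λ M → isPerfectMatching? G M ×-dec antiForcingNumberIs? G M k)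

-- The graph G_n.  Vertex labels: u_0 = 0, v_0 = 1, and for i ≥ 1
--   u_i = 4i-2, v_i = 4i-1, w_i = 4i, z_i = 4i+1   (so V = 8n+2).

u v w z : ℕ → ℕ
u zero    = 0
u (suc k) = 2 + 4 * k
v zero    = 1
v (suc k) = 3 + 4 * k
w i = 2 + u i      -- only used for i ≥ 1
z i = 2 + v i      -- only used for i ≥ 1

stepEdges : ℕ → List (ℕ × ℕ)
stepEdges k =
  (u k , u (suc k)) ∷ (v k , v (suc k)) ∷ (u (suc k) , v (suc k)) ∷
  (w (suc k) , u (suc k)) ∷ (v (suc k) , z (suc k)) ∷ []

capEdges : ℕ → List (ℕ × ℕ)
capEdges t =
  (w (1 + 2 * t) , w (2 + 2 * t)) ∷ (z (1 + 2 * t) , z (2 + 2 * t)) ∷ []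

Gedges : ℕ → List (ℕ × ℕ)
Gedges zero    = []
Gedges (suc m) =
  (u 0 , v 0) ∷ (concatMap stepEdges (upTo (2 * suc m)) ++ concatMap capEdges (upTo (suc m)))

Gn : ℕ → Graph
Gn zero    = record { V = 0 ; edges = [] }
Gn (suc m) = record { V = 2 + 8 * suc m ; edges = Gedges (suc m) }

u₀v₀ : (m : ℕ) → Fin (nE (Gn (suc m)))
u₀v₀ m = Data.Fin.zero

AfBar0 : (m : ℕ) → Poly
AfBar0 m k = countSubsets (λ M →
  isPerfectMatching? (Gn (suc m)) M ×-dec
  (¬? (u₀v₀ m ∈? M) ×-dec antiForcingNumberIs? (Gn (suc m)) M k))

-- If u₀v₀ ∉ M, then M contains u₀u₁ and v₀v₁, hence also w₁w₂ and z₁z₂, and the rest of M is a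
-- perfect matching M' of the copy of G_{n-1} on the columns 2, …, 2n; conversely every M' extends in
-- this way.  An anti-forcing set of M restricts to one of M' and must contain one of the twelve edges
-- outside the copy, for otherwise trading u₀u₁, v₀v₁ for u₀v₀, u₁v₁ gives a second perfect matching
-- avoiding it; conversely u₀v₀ together with the image of an anti-forcing set of M' anti-forces M.  Hence
-- af(G_n, M) = af(G_{n-1}, M') + 1.

module Submission where

open import Defs
open import Data.Nat using (ℕ; suc)
open import Relation.Binary.PropositionalEquality using (_≡_)

open import Level using (0ℓ)
open import Function using (id; _∘_; _⇔_; mk⇔; Equivalence)
open import Function.Properties.Equivalence using () renaming (trans to ⇔-trans; sym to ⇔-sym)
open import Algebra.Bundles using (CommutativeMonoid)
open import Data.Bool using (Bool; true; false; not; _∧_; _∨_; if_then_else_; T)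
open import Data.Bool.Properties using (T-∧; ∧-assoc; ∧-commutativeMonoid)
open import Data.Empty using (⊥-elim)
open import Data.Nat using (zero; _+_; _*_; _≤_; _<_; z≤n; s≤s; _≟_; _<?_)
open import Data.Nat.Properties
  using (≤-pred; ≤-antisym; ≤-trans; ≮⇒≥; m≤m+n; +-monoˡ-≤; +-monoʳ-<; +-cancelˡ-<; +-cancelˡ-≡;
         +-identityʳ; +-assoc; *-suc; *-distribˡ-+; +-commutativeSemigroup)
open import Data.Fin using (Fin; toℕ; fromℕ<) renaming (zero to fzero)
open import Data.Fin.Properties using (toℕ-fromℕ<; toℕ<n)
open import Data.Fin.Subset using (Subset; inside; outside; _∈_; _∉_; _⊆_; _∩_; ∁; ∣_∣)
open import Data.Fin.Subset.Properties using (drop-∷-⊆; x∈∁p⇒x∉p; x∉p⇒x∈∁p; _∈?_)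
open import Data.List using (List; []; _∷_; _++_; length; lookup; map; concatMap; applyUpTo; upTo)
open import Data.List.Properties using (map-concatMap; concatMap-cong; concatMap-map; map-applyUpTo)
open import Data.List.Membership.Propositional.Properties using (∈-upTo⁺)
open import Data.List.Relation.Unary.All using (All; []; _∷_)
import Data.List.Relation.Unary.All as All
open import Data.Vec using ([]; _∷_; tabulate; here; there)
open import Data.Vec.Properties using (∷-injectiveˡ; ∷-injectiveʳ)
open import Data.Product using (_×_; _,_; proj₁; proj₂)
open import Data.Product.Function.NonDependent.Propositional using (_×-⇔_)
open import Relation.Nullary using (yes; no; ¬_; does)
open import Relation.Nullary.Decidable using (dec-false; does-⇔; _×-dec_; ¬?)
open import Relation.Unary using (Pred; Decidable)
open import Relation.Binary.PropositionalEquality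
  using (_≗_; _≢_; refl; sym; trans; cong; cong₂; subst; module ≡-Reasoning)
open import Algebra.Properties.CommutativeSemigroup +-commutativeSemigroup
  using () renaming (x∙yz≈y∙xz to +-exchange)
open import Algebra.Properties.CommutativeSemigroup (CommutativeMonoid.commutativeSemigroup ∧-commutativeMonoid)
  using () renaming (x∙yz≈y∙xz to ∧-exchange)

open Equivalence using (to; from)

countSubsets-none : ∀ {n} {P : Pred (Subset n) 0ℓ} (P? : Decidable P) →
  (∀ S → ¬ P S) → countSubsets P? ≡ 0
countSubsets-none {zero} P? ¬P with P? []
... | yes p = ⊥-elim (¬P [] p)
... | no _  = refl
countSubsets-none {suc n} P? ¬P =
  cong₂ _+_ (countSubsets-none _ (¬P ∘ (inside ∷_))) (countSubsets-none _ (¬P ∘ (outside ∷_)))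

countSubsets-cong : ∀ {n} {P Q : Pred (Subset n) 0ℓ} (P? : Decidable P) (Q? : Decidable Q) →
  (∀ S → P S → Q S) → (∀ S → Q S → P S) → countSubsets P? ≡ countSubsets Q?
countSubsets-cong {zero} P? Q? P⇒Q Q⇒P with P? [] | Q? []
... | yes _ | yes _ = refl
... | no _  | no _  = refl
... | yes p | no ¬q = ⊥-elim (¬q (P⇒Q [] p))
... | no ¬p | yes q = ⊥-elim (¬p (Q⇒P [] q))
countSubsets-cong {suc n} P? Q? P⇒Q Q⇒P =
  cong₂ _+_ (countSubsets-cong _ _ (P⇒Q ∘ (inside ∷_)) (Q⇒P ∘ (inside ∷_)))
            (countSubsets-cong _ _ (P⇒Q ∘ (outside ∷_)) (Q⇒P ∘ (outside ∷_)))

Edge : Set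
Edge = ℕ × ℕ

Sub : List Edge → Set
Sub L = Subset (length L)

bit : Bool → ℕ
bit true  = 1
bit false = 0

∣∷∣ : ∀ {n} b (p : Subset n) → ∣ b ∷ p ∣ ≡ bit b + ∣ p ∣
∣∷∣ true  p = refl
∣∷∣ false p = refl

countSelected : (Edge → Bool) → (L : List Edge) → Sub L → ℕ
countSelected p []      []      = 0
countSelected p (e ∷ L) (b ∷ S) = bit (p e ∧ b) + countSelected p L S

countSelected-cong : ∀ {p q} → (∀ e → p e ≡ q e) → ∀ L S → countSelected p L S ≡ countSelected q L S
countSelected-cong p≗q []      []      = refl
countSelected-cong p≗q (e ∷ L) (b ∷ S) =
  cong₂ (λ c n → bit (c ∧ b) + n) (p≗q e) (countSelected-cong p≗q L S)

countSelected-none : ∀ {p} → (∀ e → p e ≡ false) → ∀ L S → countSelected p L S ≡ 0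
countSelected-none p≗false L S = trans (countSelected-cong p≗false L S) (zeros L S)
  where
  zeros : ∀ L S → countSelected (λ _ → false) L S ≡ 0
  zeros []      []      = refl
  zeros (e ∷ L) (b ∷ S) = zeros L S

incidentᵇ : ℕ → Edge → Bool
incidentᵇ x e = does (incident? x e)

degree : ℕ → (L : List Edge) → Sub L → ℕ
degree x = countSelected (incidentᵇ x)

Perfect : ℕ → (L : List Edge) → Sub L → Set
Perfect V L S = ∀ x → x < V → degree x L S ≡ 1

∣∩incident∣≡degree : ∀ x L (S : Sub L) →
  ∣ S ∩ tabulate (λ i → if incidentᵇ x (lookup L i) then inside else outside) ∣ ≡ degree x L S
∣∩incident∣≡degree x []      []      = refl
∣∩incident∣≡degree x (e ∷ L) (b ∷ S) =
  trans (head-count b (incidentᵇ x e) (S ∩ tabulate (λ i → if incidentᵇ x (lookup L i) then inside else outside)))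
        (cong (bit (incidentᵇ x e ∧ b) +_) (∣∩incident∣≡degree x L S))
  where
  head-count : ∀ {n} b c (r : Subset n) → ∣ (b ∧ (if c then inside else outside)) ∷ r ∣ ≡ bit (c ∧ b) + ∣ r ∣
  head-count true  true  r = refl
  head-count true  false r = refl
  head-count false true  r = refl
  head-count false false r = refl

isPerfectMatching⇔Perfect : ∀ G S → IsPerfectMatching G S ⇔ Perfect (V G) (edges G) S
isPerfectMatching⇔Perfect G S = mk⇔
  (λ pm x x<V → subst (λ y → degree y (edges G) S ≡ 1) (toℕ-fromℕ< x<V)
                  (trans (sym (∣∩incident∣≡degree (toℕ (fromℕ< x<V)) (edges G) S)) (pm (fromℕ< x<V))))
  (λ pf v → trans (∣∩incident∣≡degree (toℕ v) (edges G) S) (pf (toℕ v) (toℕ<n v)))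

⊆∁-sym : ∀ {n} {p q : Subset n} → p ⊆ ∁ q → q ⊆ ∁ p
⊆∁-sym p⊆∁q x∈q = x∉p⇒x∈∁p (λ x∈p → x∈∁p⇒x∉p (p⊆∁q x∈p) x∈q)

disjoint : ∀ {n} → Subset n → Subset n → Bool
disjoint []      []      = true
disjoint (a ∷ p) (b ∷ q) = not (a ∧ b) ∧ disjoint p q

⊆∁⇔disjoint : ∀ {n} (p q : Subset n) → p ⊆ ∁ q ⇔ T (disjoint p q)
⊆∁⇔disjoint p q = mk⇔ (⊆∁⇒disjoint p q) (disjoint⇒⊆∁ p q)
  where
  ⊆∁⇒disjoint : ∀ {n} (p q : Subset n) → p ⊆ ∁ q → T (disjoint p q)
  ⊆∁⇒disjoint []          []          _   = _
  ⊆∁⇒disjoint (true ∷ p)  (true ∷ q)  p⊆ with () ← p⊆ here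
  ⊆∁⇒disjoint (true ∷ p)  (false ∷ q) p⊆ = ⊆∁⇒disjoint p q (drop-∷-⊆ p⊆)
  ⊆∁⇒disjoint (false ∷ p) (b ∷ q)     p⊆ = ⊆∁⇒disjoint p q (drop-∷-⊆ p⊆)

  disjoint⇒⊆∁ : ∀ {n} (p q : Subset n) → T (disjoint p q) → p ⊆ ∁ q
  disjoint⇒⊆∁ (true ∷ p) (false ∷ q) d here      = here
  disjoint⇒⊆∁ (a ∷ p)    (b ∷ q)     d (there x) = there (disjoint⇒⊆∁ p q (proj₂ (to T-∧ d)) x)

¬⊆∁⇒nonempty : ∀ {n} {p q : Subset n} → ¬ (p ⊆ ∁ q) → 1 ≤ ∣ q ∣
¬⊆∁⇒nonempty {p = p} {q} ¬p⊆∁q = ¬disjoint⇒nonempty p q (¬p⊆∁q ∘ from (⊆∁⇔disjoint p q))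
  where
  ¬disjoint⇒nonempty : ∀ {n} (p q : Subset n) → ¬ T (disjoint p q) → 1 ≤ ∣ q ∣
  ¬disjoint⇒nonempty []          []          ¬d = ⊥-elim (¬d _)
  ¬disjoint⇒nonempty (a ∷ p)     (true ∷ q)  ¬d = s≤s z≤n
  ¬disjoint⇒nonempty (true ∷ p)  (false ∷ q) ¬d = ¬disjoint⇒nonempty p q ¬d
  ¬disjoint⇒nonempty (false ∷ p) (false ∷ q) ¬d = ¬disjoint⇒nonempty p q ¬d

avoidingWithAf? : (G : Graph) (e : Fin (nE G)) (k : ℕ) →
  Decidable (λ M → IsPerfectMatching G M × e ∉ M × AntiForcingNumberIs G M k)
avoidingWithAf? G e k M = isPerfectMatching? G M ×-dec (¬? (e ∈? M) ×-dec antiForcingNumberIs? G M k)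

-- Opaque, and written exactly as AfBar0: unfolding countSubsets over a graph with many explicitly
-- listed edges is exponential, so every conversion involving it has to be decided syntactically.
opaque
  AfAvoiding : (G : Graph) → Fin (nE G) → Poly
  AfAvoiding G e k = countSubsets (λ M →
    isPerfectMatching? G M ×-dec (¬? (e ∈? M) ×-dec antiForcingNumberIs? G M k))

opaque
  unfolding AfAvoiding

  AfAvoiding-unfold : ∀ G e k → AfAvoiding G e k ≡ countSubsets (avoidingWithAf? G e k)
  AfAvoiding-unfold G e k = refl

  AfBar0≡AfAvoiding : ∀ m k → AfBar0 m k ≡ AfAvoiding (Gn (suc m)) (u₀v₀ m) k
  AfBar0≡AfAvoiding m k = refl

module Relabelling (φ : ℕ → ℕ) where

  relabel : Edge → Edge
  relabel (a , b) = φ a , φ b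

  data Extension : List Edge → List Edge → List Edge → Set where
    []  : Extension [] [] []
    old : ∀ {e L L' N} → Extension L L' N → Extension (relabel e ∷ L) (e ∷ L') N
    new : ∀ {e L L' N} → Extension L L' N → Extension (e ∷ L) L' (e ∷ N)

  private
    variable
      L L' N L₂ L₂' N₂ : List Edge

  restrict : Extension L L' N → Sub L → Sub L'
  restrict []      []      = []
  restrict (old x) (b ∷ S) = b ∷ restrict x S
  restrict (new x) (_ ∷ S) = restrict x S

  newPart : Extension L L' N → Sub L → Sub N
  newPart []      []      = []
  newPart (old x) (_ ∷ S) = newPart x S
  newPart (new x) (b ∷ S) = b ∷ newPart x S

  glue : Extension L L' N → Sub N → Sub L' → Sub L
  glue []      []      []       = []
  glue (old x) B       (b ∷ S') = b ∷ glue x B S'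
  glue (new x) (b ∷ B) S'       = b ∷ glue x B S'

  restrict-glue : (x : Extension L L' N) (B : Sub N) (S' : Sub L') → restrict x (glue x B S') ≡ S'
  restrict-glue []      []      []       = refl
  restrict-glue (old x) B       (b ∷ S') = cong (b ∷_) (restrict-glue x B S')
  restrict-glue (new x) (b ∷ B) S'       = restrict-glue x B S'

  newPart-glue : (x : Extension L L' N) (B : Sub N) (S' : Sub L') → newPart x (glue x B S') ≡ B
  newPart-glue []      []      []       = refl
  newPart-glue (old x) B       (b ∷ S') = newPart-glue x B S'
  newPart-glue (new x) (b ∷ B) S'       = cong (b ∷_) (newPart-glue x B S')

  glue-newPart-restrict : (x : Extension L L' N) (S : Sub L) → glue x (newPart x S) (restrict x S) ≡ S
  glue-newPart-restrict []      []      = refl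
  glue-newPart-restrict (old x) (b ∷ S) = cong (b ∷_) (glue-newPart-restrict x S)
  glue-newPart-restrict (new x) (b ∷ S) = cong (b ∷_) (glue-newPart-restrict x S)

  countSubsets-glue : (x : Extension L L' N) (B : Sub N) {P : Pred (Sub L) 0ℓ} (P? : Decidable P) →
    (∀ S → P S → newPart x S ≡ B) → countSubsets P? ≡ countSubsets (λ S' → P? (glue x B S'))
  countSubsets-glue []      []          P? _ = refl
  countSubsets-glue (old x) B           P? h =
    cong₂ _+_ (countSubsets-glue x B _ (h ∘ (inside ∷_))) (countSubsets-glue x B _ (h ∘ (outside ∷_)))
  countSubsets-glue (new x) (true ∷ B)  P? h =
    trans (cong₂ _+_ (countSubsets-glue x B _ (λ S → ∷-injectiveʳ ∘ h (inside ∷ S)))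
                     (countSubsets-none _ (λ S → (λ ()) ∘ ∷-injectiveˡ ∘ h (outside ∷ S))))
          (+-identityʳ _)
  countSubsets-glue (new x) (false ∷ B) P? h =
    cong₂ _+_ (countSubsets-none _ (λ S → (λ ()) ∘ ∷-injectiveˡ ∘ h (inside ∷ S)))
              (countSubsets-glue x B _ (λ S → ∷-injectiveʳ ∘ h (outside ∷ S)))

  countSelected-split : ∀ p (x : Extension L L' N) S →
    countSelected p L S ≡ countSelected p N (newPart x S) + countSelected (p ∘ relabel) L' (restrict x S)
  countSelected-split p []                      []      = refl
  countSelected-split p (old {e} {L} {L'} {N} x) (b ∷ S) = begin
    bit (p (relabel e) ∧ b) + countSelected p L S
      ≡⟨ cong (bit (p (relabel e) ∧ b) +_) (countSelected-split p x S) ⟩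
    bit (p (relabel e) ∧ b) + (countSelected p N (newPart x S) + countSelected (p ∘ relabel) L' (restrict x S))
      ≡⟨ +-exchange (bit (p (relabel e) ∧ b)) (countSelected p N (newPart x S)) _ ⟩
    countSelected p N (newPart x S) + (bit (p (relabel e) ∧ b) + countSelected (p ∘ relabel) L' (restrict x S)) ∎
    where open ≡-Reasoning
  countSelected-split p (new {e} {L} {L'} {N} x) (b ∷ S) = begin
    bit (p e ∧ b) + countSelected p L S
      ≡⟨ cong (bit (p e ∧ b) +_) (countSelected-split p x S) ⟩
    bit (p e ∧ b) + (countSelected p N (newPart x S) + countSelected (p ∘ relabel) L' (restrict x S))
      ≡⟨ sym (+-assoc (bit (p e ∧ b)) (countSelected p N (newPart x S)) _) ⟩
    (bit (p e ∧ b) + countSelected p N (newPart x S)) + countSelected (p ∘ relabel) L' (restrict x S) ∎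
    where open ≡-Reasoning

  ∣∣-split : (x : Extension L L' N) (S : Sub L) → ∣ S ∣ ≡ ∣ newPart x S ∣ + ∣ restrict x S ∣
  ∣∣-split []      []      = refl
  ∣∣-split (old x) (b ∷ S) = begin
    ∣ b ∷ S ∣                                      ≡⟨ ∣∷∣ b S ⟩
    bit b + ∣ S ∣                                  ≡⟨ cong (bit b +_) (∣∣-split x S) ⟩
    bit b + (∣ newPart x S ∣ + ∣ restrict x S ∣)   ≡⟨ +-exchange (bit b) ∣ newPart x S ∣ ∣ restrict x S ∣ ⟩
    ∣ newPart x S ∣ + (bit b + ∣ restrict x S ∣)   ≡⟨ cong (∣ newPart x S ∣ +_) (sym (∣∷∣ b (restrict x S))) ⟩
    ∣ newPart x S ∣ + ∣ b ∷ restrict x S ∣         ∎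
    where open ≡-Reasoning
  ∣∣-split (new x) (b ∷ S) = begin
    ∣ b ∷ S ∣                                      ≡⟨ ∣∷∣ b S ⟩
    bit b + ∣ S ∣                                  ≡⟨ cong (bit b +_) (∣∣-split x S) ⟩
    bit b + (∣ newPart x S ∣ + ∣ restrict x S ∣)   ≡⟨ sym (+-assoc (bit b) ∣ newPart x S ∣ ∣ restrict x S ∣) ⟩
    (bit b + ∣ newPart x S ∣) + ∣ restrict x S ∣   ≡⟨ cong (_+ ∣ restrict x S ∣) (sym (∣∷∣ b (newPart x S))) ⟩
    ∣ b ∷ newPart x S ∣ + ∣ restrict x S ∣         ∎
    where open ≡-Reasoning

  disjoint-split : (x : Extension L L' N) (S T : Sub L) →
    disjoint S T ≡ disjoint (newPart x S) (newPart x T) ∧ disjoint (restrict x S) (restrict x T)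
  disjoint-split []      []      []      = refl
  disjoint-split (old x) (a ∷ S) (b ∷ T) = trans (cong (not (a ∧ b) ∧_) (disjoint-split x S T))
    (∧-exchange (not (a ∧ b)) (disjoint (newPart x S) (newPart x T)) _)
  disjoint-split (new x) (a ∷ S) (b ∷ T) = trans (cong (not (a ∧ b) ∧_) (disjoint-split x S T))
    (sym (∧-assoc (not (a ∧ b)) (disjoint (newPart x S) (newPart x T)) _))

  ⊆∁-glue⇔ : (x : Extension L L' N) (B : Sub N) (S' : Sub L') (R : Sub L) →
    glue x B S' ⊆ ∁ R ⇔ (B ⊆ ∁ (newPart x R) × S' ⊆ ∁ (restrict x R))
  ⊆∁-glue⇔ x B S' R = ⇔-trans (⊆∁⇔disjoint (glue x B S') R)
    (subst (λ d → T d ⇔ (B ⊆ ∁ (newPart x R) × S' ⊆ ∁ (restrict x R))) (sym split)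
      (⇔-trans T-∧ (⇔-sym (⊆∁⇔disjoint B (newPart x R)) ×-⇔ ⇔-sym (⊆∁⇔disjoint S' (restrict x R)))))
    where
    split : disjoint (glue x B S') R ≡ disjoint B (newPart x R) ∧ disjoint S' (restrict x R)
    split = trans (disjoint-split x (glue x B S') R)
      (cong₂ (λ B₁ S₁ → disjoint B₁ (newPart x R) ∧ disjoint S₁ (restrict x R))
             (newPart-glue x B S') (restrict-glue x B S'))

  glue-injectiveʳ : (x : Extension L L' N) (B : Sub N) {S' T' : Sub L'} →
    glue x B S' ≡ glue x B T' → S' ≡ T'
  glue-injectiveʳ x B {S'} {T'} eq = begin
    S'                         ≡⟨ sym (restrict-glue x B S') ⟩
    restrict x (glue x B S')   ≡⟨ cong (restrict x) eq ⟩
    restrict x (glue x B T')   ≡⟨ restrict-glue x B T' ⟩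
    T'                         ∎
    where open ≡-Reasoning

  relabelled : ∀ L → Extension (map relabel L) L []
  relabelled []      = []
  relabelled (e ∷ L) = old (relabelled L)

  _++ᴱ_ : Extension L L' N → Extension L₂ L₂' N₂ → Extension (L ++ L₂) (L' ++ L₂') (N ++ N₂)
  []    ++ᴱ y = y
  old x ++ᴱ y = old (x ++ᴱ y)
  new x ++ᴱ y = new (x ++ᴱ y)

  AfAvoiding≡x*Af : (G G' : Graph) (x : Extension (edges G) (edges G') N) (e : Fin (nE G))
    (R : Sub N) →
    (∀ S → IsPerfectMatching G S → e ∉ S → newPart x S ≡ R) →
    (∀ M' → e ∉ glue x R M') →
    (∀ M' → IsPerfectMatching G (glue x R M') ⇔ IsPerfectMatching G' M') →
    (∀ M' → IsPerfectMatching G' M' → ¬ AntiForcingNumberIs G (glue x R M') 0) →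
    (∀ M' j → IsPerfectMatching G' M' →
      AntiForcingNumberIs G (glue x R M') (suc j) ⇔ AntiForcingNumberIs G' M' j) →
    ∀ k → AfAvoiding G e k ≡ x* (Af G') k
  AfAvoiding≡x*Af G G' x e R forced e∉ pm⇔ af-nonzero af-suc⇔ k = begin
    AfAvoiding G e k                                         ≡⟨ AfAvoiding-unfold G e k ⟩
    countSubsets (avoidingWithAf? G e k)                     ≡⟨ countSubsets-glue x R (avoidingWithAf? G e k)
                                                                  (λ S (pm , e∉S , _) → forced S pm e∉S) ⟩
    countSubsets (λ M' → avoidingWithAf? G e k (glue x R M')) ≡⟨ count k ⟩
    x* (Af G') k                                             ∎
    where
    open ≡-Reasoning
    count : ∀ k → countSubsets (λ M' → avoidingWithAf? G e k (glue x R M')) ≡ x* (Af G') k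
    count zero    = countSubsets-none (λ M' → avoidingWithAf? G e zero (glue x R M'))
      λ M' (pm , _ , af) → af-nonzero M' (to (pm⇔ M') pm) af
    count (suc j) = countSubsets-cong (λ M' → avoidingWithAf? G e (suc j) (glue x R M'))
      (λ M' → isPerfectMatching? G' M' ×-dec antiForcingNumberIs? G' M' j)
      (λ M' (pm , _ , af) → to (pm⇔ M') pm , to (af-suc⇔ M' j (to (pm⇔ M') pm)) af)
      (λ M' (pm' , af) → from (pm⇔ M') pm' , e∉ M' , from (af-suc⇔ M' j pm') af)

  module _ (φ-injective : ∀ {a b} → φ a ≡ φ b → a ≡ b) where

    incidentᵇ-relabel : ∀ y e → incidentᵇ (φ y) (relabel e) ≡ incidentᵇ y e
    incidentᵇ-relabel y (a , b) = cong₂ _∨_ (≟-relabel a) (≟-relabel b)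
      where
      ≟-relabel : ∀ a → does (φ y ≟ φ a) ≡ does (y ≟ a)
      ≟-relabel a = does-⇔ (mk⇔ φ-injective (cong φ)) (φ y ≟ φ a) (y ≟ a)

    degree-relabel : ∀ y L S → countSelected (incidentᵇ (φ y) ∘ relabel) L S ≡ degree y L S
    degree-relabel y = countSelected-cong (incidentᵇ-relabel y)

  degree-relabel-∉ : ∀ x → (∀ y → φ y ≢ x) → ∀ L S → countSelected (incidentᵇ x ∘ relabel) L S ≡ 0
  degree-relabel-∉ x x∉ = countSelected-none λ (a , b) →
    cong₂ _∨_ (dec-false (x ≟ φ a) (x∉ a ∘ sym)) (dec-false (x ≟ φ b) (x∉ b ∘ sym))

-- u_i ↦ u_{i+2}, v_i ↦ v_{i+2}, w_i ↦ w_{i+2}, z_i ↦ z_{i+2} on the labels of Defs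
shift₂ : ℕ → ℕ
shift₂ 0             = 6
shift₂ 1             = 7
shift₂ (suc (suc y)) = 10 + y

shift₂-injective : ∀ {a b} → shift₂ a ≡ shift₂ b → a ≡ b
shift₂-injective {0}           {0}           _  = refl
shift₂-injective {1}           {1}           _  = refl
shift₂-injective {suc (suc a)} {suc (suc b)} eq = cong (2 +_) (+-cancelˡ-≡ 10 a b eq)
shift₂-injective {0}           {1}           ()
shift₂-injective {0}           {suc (suc b)} ()
shift₂-injective {1}           {0}           ()
shift₂-injective {1}           {suc (suc b)} ()
shift₂-injective {suc (suc a)} {0}           ()
shift₂-injective {suc (suc a)} {1}           ()

open Relabelling shift₂

-- u₀v₀, u₀u₁, v₀v₁, u₁v₁, w₁u₁, v₁z₁, u₁u₂, v₁v₂, w₂u₂, v₂z₂, w₁w₂, z₁z₂: the edges of G_n that are not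
-- images of edges of G_{n-1} (u₂v₂ is the image of u₀v₀).
blockEdges : List Edge
blockEdges = (0 , 1) ∷ (0 , 2) ∷ (1 , 3) ∷ (2 , 3) ∷ (4 , 2) ∷ (3 , 5) ∷
             (2 , 6) ∷ (3 , 7) ∷ (8 , 6) ∷ (7 , 9) ∷ (4 , 8) ∷ (5 , 9) ∷ []

-- {u₀u₁, v₀v₁, w₁w₂, z₁z₂}, {u₀v₀, u₁v₁, w₁w₂, z₁z₂} and {u₀v₀}
blockRails blockRungs blockU₀V₀ : Sub blockEdges
blockRails = outside ∷ inside ∷ inside ∷ outside ∷ outside ∷ outside ∷
             outside ∷ outside ∷ outside ∷ outside ∷ inside ∷ inside ∷ []
blockRungs = inside ∷ outside ∷ outside ∷ inside ∷ outside ∷ outside ∷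
             outside ∷ outside ∷ outside ∷ outside ∷ inside ∷ inside ∷ []
blockU₀V₀  = inside ∷ outside ∷ outside ∷ outside ∷ outside ∷ outside ∷
             outside ∷ outside ∷ outside ∷ outside ∷ outside ∷ outside ∷ []

-- The degree of a vertex in the block part of a perfect matching of G_n whose other part is a perfect
-- matching of the copy of G_{n-1}: u₂ = 6, v₂ = 7 and the vertices from 10 on are covered by the copy.
blockDemand : ℕ → ℕ
blockDemand 6 = 0
blockDemand 7 = 0
blockDemand (suc (suc (suc (suc (suc (suc (suc (suc (suc (suc _)))))))))) = 0
blockDemand _ = 1

blockDemand-shift₂ : ∀ y → blockDemand (shift₂ y) ≡ 0
blockDemand-shift₂ 0             = refl
blockDemand-shift₂ 1             = refl
blockDemand-shift₂ (suc (suc y)) = refl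

shift₂-∉ : ∀ {x} → blockDemand x ≡ 1 → ∀ y → shift₂ y ≢ x
shift₂-∉ demand y refl with () ← trans (sym demand) (blockDemand-shift₂ y)

blockDemand-≥10 : ∀ {x} → 10 ≤ x → blockDemand x ≡ 0
blockDemand-≥10 (s≤s (s≤s (s≤s (s≤s (s≤s (s≤s (s≤s (s≤s (s≤s (s≤s _)))))))))) = refl

blockDemand≡1⇒<10 : ∀ {x} → blockDemand x ≡ 1 → x < 10
blockDemand≡1⇒<10 {x} demand with x <? 10
... | yes x<10 = x<10
... | no  x≮10 with () ← trans (sym demand) (blockDemand-≥10 (≮⇒≥ x≮10))

degree-blockEdges-≥10 : ∀ {x} → 10 ≤ x → (B : Sub blockEdges) → degree x blockEdges B ≡ 0
degree-blockEdges-≥10 (s≤s (s≤s (s≤s (s≤s (s≤s (s≤s (s≤s (s≤s (s≤s (s≤s _))))))))))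
  (_ ∷ _ ∷ _ ∷ _ ∷ _ ∷ _ ∷ _ ∷ _ ∷ _ ∷ _ ∷ _ ∷ _ ∷ []) = refl

CoversBlock : Sub blockEdges → Set
CoversBlock B = All (λ x → degree x blockEdges B ≡ blockDemand x) (upTo 10)

coversBlock-rails : CoversBlock blockRails
coversBlock-rails = refl ∷ refl ∷ refl ∷ refl ∷ refl ∷ refl ∷ refl ∷ refl ∷ refl ∷ refl ∷ []

coversBlock-rungs : CoversBlock blockRungs
coversBlock-rungs = refl ∷ refl ∷ refl ∷ refl ∷ refl ∷ refl ∷ refl ∷ refl ∷ refl ∷ refl ∷ []

coversBlock-degree : ∀ B → CoversBlock B → ∀ x → degree x blockEdges B ≡ blockDemand x
coversBlock-degree B covers x with x <? 10
... | yes x<10 = All.lookup covers (∈-upTo⁺ x<10)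
... | no  x≮10 = trans (degree-blockEdges-≥10 (≮⇒≥ x≮10) B) (sym (blockDemand-≥10 (≮⇒≥ x≮10)))

data BlockView : ℕ → Set where
  unshifted : ∀ {x} → blockDemand x ≡ 1 → BlockView x
  shifted   : ∀ y → BlockView (shift₂ y)

blockView : ∀ x → BlockView x
blockView 0 = unshifted refl
blockView 1 = unshifted refl
blockView 2 = unshifted refl
blockView 3 = unshifted refl
blockView 4 = unshifted refl
blockView 5 = unshifted refl
blockView 6 = shifted 0
blockView 7 = shifted 1
blockView 8 = unshifted refl
blockView 9 = unshifted refl
blockView (suc (suc (suc (suc (suc (suc (suc (suc (suc (suc t)))))))))) = shifted (2 + t)

shift₂-< : ∀ {W} y → y < 2 + W → shift₂ y < 10 + W
shift₂-< {W} 0             _  = m≤m+n 7 (3 + W)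
shift₂-< {W} 1             _  = m≤m+n 8 (2 + W)
shift₂-<     (suc (suc y)) y< = +-monoʳ-< 8 y<

shift₂-<⁻¹ : ∀ {W} y → shift₂ y < 10 + W → y < 2 + W
shift₂-<⁻¹     0             _  = s≤s z≤n
shift₂-<⁻¹     1             _  = s≤s (s≤s z≤n)
shift₂-<⁻¹ {W} (suc (suc y)) y< = +-cancelˡ-< 8 (2 + y) (2 + W) y<

blockRails-forced : (B : Sub blockEdges) → fzero ∉ B →
  (∀ x → blockDemand x ≡ 1 → degree x blockEdges B ≡ 1) → B ≡ blockRails
blockRails-forced (inside ∷ _) u₀v₀∉B _ = ⊥-elim (u₀v₀∉B here)
blockRails-forced (outside ∷ b₁ ∷ b₂ ∷ b₃ ∷ b₄ ∷ b₅ ∷ b₆ ∷ b₇ ∷ b₈ ∷ b₉ ∷ b₁₀ ∷ b₁₁ ∷ []) _ covered =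
  forced b₁ b₂ b₃ b₄ b₅ b₆ b₇ b₈ b₉ b₁₀ b₁₁
    (covered 0 refl) (covered 1 refl) (covered 2 refl) (covered 3 refl)
    (covered 4 refl) (covered 5 refl) (covered 8 refl) (covered 9 refl)
  where
  forced : ∀ b₁ b₂ b₃ b₄ b₅ b₆ b₇ b₈ b₉ b₁₀ b₁₁ →
    let B = outside ∷ b₁ ∷ b₂ ∷ b₃ ∷ b₄ ∷ b₅ ∷ b₆ ∷ b₇ ∷ b₈ ∷ b₉ ∷ b₁₀ ∷ b₁₁ ∷ [] in
    degree 0 blockEdges B ≡ 1 → degree 1 blockEdges B ≡ 1 → degree 2 blockEdges B ≡ 1 →
    degree 3 blockEdges B ≡ 1 → degree 4 blockEdges B ≡ 1 → degree 5 blockEdges B ≡ 1 →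
    degree 8 blockEdges B ≡ 1 → degree 9 blockEdges B ≡ 1 → B ≡ blockRails
  forced false _     _     _     _     _     _     _     _     _     _     () _  _  _  _  _  _  _
  forced true  false _     _     _     _     _     _     _     _     _     _  () _  _  _  _  _  _
  forced true  true  true  _     _     _     _     _     _     _     _     _  _  () _  _  _  _  _
  forced true  true  false true  _     _     _     _     _     _     _     _  _  () _  _  _  _  _
  forced true  true  false false _     true  _     _     _     _     _     _  _  () _  _  _  _  _
  forced true  true  false false true  false _     _     _     _     _     _  _  _  () _  _  _  _
  forced true  true  false false false false true  _     _     _     _     _  _  _  () _  _  _  _
  forced true  true  false false false false false _     _     false _     _  _  _  _  () _  _  _
  forced true  true  false false false false false _     _     true  false _  _  _  _  _  () _  _
  forced true  true  false false false false false true  _     true  true  _  _  _  _  _  _  () _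
  forced true  true  false false false false false false true  true  true  _  _  _  _  _  _  _  ()
  forced true  true  false false false false false false false true  true  _  _  _  _  _  _  _  _ = refl

-- small is G_{n-1} on 2 + W vertices with step edges Ls and cap edges Lc (for n = 1 the single edge
-- u₀v₀), and big is G_n.
module Block (W : ℕ) (Ls Lc : List Edge) where

  smallEdges bigEdges : List Edge
  smallEdges = (0 , 1) ∷ Ls ++ Lc
  bigEdges   = (0 , 1) ∷ stepEdges 0 ++ stepEdges 1 ++ map relabel Ls ++ capEdges 0 ++ map relabel Lc

  small big : Graph
  small = record { V = 2 + W ; edges = smallEdges }
  big   = record { V = 10 + W ; edges = bigEdges }

  ext : Extension (edges big) (edges small) blockEdges
  ext = new (new (new (new (new (new (new (new (old (new (new
          (relabelled Ls ++ᴱ new (new (relabelled Lc)))))))))))))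

  degree-big-unshifted : ∀ {x} → blockDemand x ≡ 1 → ∀ S →
    degree x bigEdges S ≡ degree x blockEdges (newPart ext S)
  degree-big-unshifted {x} demand S = begin
    degree x bigEdges S
      ≡⟨ countSelected-split (incidentᵇ x) ext S ⟩
    degree x blockEdges (newPart ext S) + countSelected (incidentᵇ x ∘ relabel) smallEdges (restrict ext S)
      ≡⟨ cong (degree x blockEdges (newPart ext S) +_)
              (degree-relabel-∉ x (shift₂-∉ demand) smallEdges (restrict ext S)) ⟩
    degree x blockEdges (newPart ext S) + 0
      ≡⟨ +-identityʳ _ ⟩
    degree x blockEdges (newPart ext S) ∎
    where open ≡-Reasoning

  degree-big-shifted : ∀ y S → degree (shift₂ y) bigEdges S ≡
    degree (shift₂ y) blockEdges (newPart ext S) + degree y smallEdges (restrict ext S)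
  degree-big-shifted y S = trans (countSelected-split (incidentᵇ (shift₂ y)) ext S)
    (cong (degree (shift₂ y) blockEdges (newPart ext S) +_)
          (degree-relabel shift₂-injective y smallEdges (restrict ext S)))

  perfect-big⇔small : ∀ S → CoversBlock (newPart ext S) →
    Perfect (10 + W) bigEdges S ⇔ Perfect (2 + W) smallEdges (restrict ext S)
  perfect-big⇔small S covers = mk⇔ down up
    where
    degree-shifted : ∀ y → degree (shift₂ y) bigEdges S ≡ degree y smallEdges (restrict ext S)
    degree-shifted y = trans (degree-big-shifted y S)
      (cong (_+ degree y smallEdges (restrict ext S))
            (trans (coversBlock-degree (newPart ext S) covers (shift₂ y)) (blockDemand-shift₂ y)))

    down : Perfect (10 + W) bigEdges S → Perfect (2 + W) smallEdges (restrict ext S)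
    down perfect y y< = trans (sym (degree-shifted y)) (perfect (shift₂ y) (shift₂-< y y<))

    up : Perfect (2 + W) smallEdges (restrict ext S) → Perfect (10 + W) bigEdges S
    up perfect x x< with blockView x
    ... | unshifted demand =
      trans (degree-big-unshifted demand S) (trans (coversBlock-degree (newPart ext S) covers x) demand)
    ... | shifted y        = trans (degree-shifted y) (perfect y (shift₂-<⁻¹ y x<))

  isPerfectMatching⇔restrict : ∀ S → CoversBlock (newPart ext S) →
    IsPerfectMatching big S ⇔ IsPerfectMatching small (restrict ext S)
  isPerfectMatching⇔restrict S covers =
    ⇔-trans (isPerfectMatching⇔Perfect big S)
      (⇔-trans (perfect-big⇔small S covers) (⇔-sym (isPerfectMatching⇔Perfect small (restrict ext S))))

  isPerfectMatching-glue⇔ : ∀ {B} M' → CoversBlock B →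
    IsPerfectMatching big (glue ext B M') ⇔ IsPerfectMatching small M'
  isPerfectMatching-glue⇔ {B} M' covers =
    subst (λ S' → IsPerfectMatching big (glue ext B M') ⇔ IsPerfectMatching small S') (restrict-glue ext B M')
      (isPerfectMatching⇔restrict (glue ext B M') (subst CoversBlock (sym (newPart-glue ext B M')) covers))

  u₀v₀∈newPart⇒u₀v₀∈ : ∀ {S} → fzero ∈ newPart ext S → fzero ∈ S
  u₀v₀∈newPart⇒u₀v₀∈ {inside ∷ _} here = here

  isPerfectMatching⇒rails : ∀ S → IsPerfectMatching big S → fzero ∉ newPart ext S →
    newPart ext S ≡ blockRails
  isPerfectMatching⇒rails S pm u₀v₀∉ = blockRails-forced (newPart ext S) u₀v₀∉ λ x demand →
    trans (sym (degree-big-unshifted demand S))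
          (to (isPerfectMatching⇔Perfect big S) pm x (≤-trans (blockDemand≡1⇒<10 demand) (m≤m+n 10 W)))

  extendByRails : Sub smallEdges → Sub bigEdges
  extendByRails = glue ext blockRails

  module _ {M' : Sub smallEdges} where

    antiForcing-avoids : ∀ {A} → IsAntiForcingSet big (extendByRails M') A →
      blockRails ⊆ ∁ (newPart ext A) × M' ⊆ ∁ (restrict ext A)
    antiForcing-avoids {A} (A⊆∁M , _) = to (⊆∁-glue⇔ ext blockRails M' A) (⊆∁-sym A⊆∁M)

    antiForcing-restrict : ∀ {A} → IsAntiForcingSet big (extendByRails M') A →
      IsAntiForcingSet small M' (restrict ext A)
    antiForcing-restrict {A} anti@(_ , unique) =
      ⊆∁-sym M'⊆∁A ,
      λ N' pm N'⊆∁A → glue-injectiveʳ ext blockRails (unique (extendByRails N')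
        (from (isPerfectMatching-glue⇔ N' coversBlock-rails) pm)
        (from (⊆∁-glue⇔ ext blockRails N' A) (rails⊆∁A , N'⊆∁A)))
      where
      rails⊆∁A = proj₁ (antiForcing-avoids anti)
      M'⊆∁A    = proj₂ (antiForcing-avoids anti)

    antiForcing-size : ∀ {A} → IsPerfectMatching small M' → IsAntiForcingSet big (extendByRails M') A →
      suc ∣ restrict ext A ∣ ≤ ∣ A ∣
    antiForcing-size {A} pm anti@(_ , unique) = subst (suc ∣ restrict ext A ∣ ≤_) (sym (∣∣-split ext A))
      (+-monoˡ-≤ ∣ restrict ext A ∣ (¬⊆∁⇒nonempty rungs-meet-A))
      where
      rungs-meet-A : ¬ (blockRungs ⊆ ∁ (newPart ext A))
      rungs-meet-A rungs⊆∁A with unique (glue ext blockRungs M')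
        (from (isPerfectMatching-glue⇔ M' coversBlock-rungs) pm)
        (from (⊆∁-glue⇔ ext blockRungs M' A) (rungs⊆∁A , proj₂ (antiForcing-avoids anti)))
      ... | ()

    antiForcing-glue : ∀ {A'} → IsAntiForcingSet small M' A' →
      IsAntiForcingSet big (extendByRails M') (glue ext blockU₀V₀ A')
    antiForcing-glue {A'} (A'⊆∁M' , unique) =
      from (⊆∁-glue⇔ ext blockU₀V₀ A' (extendByRails M'))
        ( subst (λ B → blockU₀V₀ ⊆ ∁ B) (sym (newPart-glue ext blockRails M'))
            (from (⊆∁⇔disjoint blockU₀V₀ blockRails) _)
        , subst (λ S' → A' ⊆ ∁ S') (sym (restrict-glue ext blockRails M')) A'⊆∁M') ,
      λ N pm N⊆∁A → unique-extension N pm (to (⊆∁-glue⇔ ext blockU₀V₀ A' N) (⊆∁-sym N⊆∁A))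
      where
      unique-extension : ∀ N → IsPerfectMatching big N →
        blockU₀V₀ ⊆ ∁ (newPart ext N) × A' ⊆ ∁ (restrict ext N) → N ≡ extendByRails M'
      unique-extension N pm (u₀v₀⊆∁N , A'⊆∁N) = begin
        N                                          ≡⟨ sym (glue-newPart-restrict ext N) ⟩
        glue ext (newPart ext N) (restrict ext N)  ≡⟨ cong (λ B → glue ext B (restrict ext N)) rails ⟩
        extendByRails (restrict ext N)             ≡⟨ cong extendByRails
                                                        (unique (restrict ext N) pm' (⊆∁-sym A'⊆∁N)) ⟩
        extendByRails M'                           ∎
        where
        open ≡-Reasoning
        rails : newPart ext N ≡ blockRails
        rails = isPerfectMatching⇒rails N pm (x∈∁p⇒x∉p (u₀v₀⊆∁N here))
        pm' : IsPerfectMatching small (restrict ext N)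
        pm' = to (isPerfectMatching⇔restrict N (subst CoversBlock (sym rails) coversBlock-rails)) pm

    ∣glue-u₀v₀∣ : ∀ A' → ∣ glue ext blockU₀V₀ A' ∣ ≡ suc ∣ A' ∣
    ∣glue-u₀v₀∣ A' = trans (∣∣-split ext (glue ext blockU₀V₀ A'))
      (cong₂ (λ (B : Sub blockEdges) (S' : Sub smallEdges) → ∣ B ∣ + ∣ S' ∣)
             (newPart-glue ext blockU₀V₀ A') (restrict-glue ext blockU₀V₀ A'))

    af-suc⇔ : ∀ j → IsPerfectMatching small M' →
      AntiForcingNumberIs big (extendByRails M') (suc j) ⇔ AntiForcingNumberIs small M' j
    af-suc⇔ j pm = mk⇔ down up
      where
      down : AntiForcingNumberIs big (extendByRails M') (suc j) → AntiForcingNumberIs small M' j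
      down ((A , anti , ∣A∣≡1+j) , minimal) =
        (restrict ext A , antiForcing-restrict anti ,
          ≤-antisym (≤-pred (subst (suc ∣ restrict ext A ∣ ≤_) ∣A∣≡1+j (antiForcing-size pm anti)))
                    (minimal′ (restrict ext A) (antiForcing-restrict anti))) ,
        minimal′
        where
        minimal′ : ∀ A' → IsAntiForcingSet small M' A' → j ≤ ∣ A' ∣
        minimal′ A' anti' =
          ≤-pred (subst (suc j ≤_) (∣glue-u₀v₀∣ A') (minimal (glue ext blockU₀V₀ A') (antiForcing-glue anti')))

      up : AntiForcingNumberIs small M' j → AntiForcingNumberIs big (extendByRails M') (suc j)
      up ((A' , anti' , ∣A'∣≡j) , minimal′) =
        (glue ext blockU₀V₀ A' , antiForcing-glue anti' , trans (∣glue-u₀v₀∣ A') (cong suc ∣A'∣≡j)) ,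
        λ A anti → ≤-trans (s≤s (minimal′ (restrict ext A) (antiForcing-restrict anti)))
                           (antiForcing-size pm anti)

    af-nonzero : IsPerfectMatching small M' → ¬ AntiForcingNumberIs big (extendByRails M') 0
    af-nonzero pm ((A , anti , ∣A∣≡0) , _)
      with () ← subst (suc ∣ restrict ext A ∣ ≤_) ∣A∣≡0 (antiForcing-size pm anti)

  AfAvoiding-big : ∀ k → AfAvoiding big fzero k ≡ x* (Af small) k
  AfAvoiding-big = AfAvoiding≡x*Af big small ext fzero blockRails
    (λ S pm u₀v₀∉S → isPerfectMatching⇒rails S pm (u₀v₀∉S ∘ u₀v₀∈newPart⇒u₀v₀∈))
    (λ M' ())
    (λ M' → isPerfectMatching-glue⇔ M' coversBlock-rails)
    (λ M' → af-nonzero)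
    (λ M' j → af-suc⇔ j)

u-shift₂ : ∀ k → shift₂ (u k) ≡ u (2 + k)
u-shift₂ zero    = refl
u-shift₂ (suc k) = cong (2 +_) (sym (*-distribˡ-+ 4 2 k))

v-shift₂ : ∀ k → shift₂ (v k) ≡ v (2 + k)
v-shift₂ zero    = refl
v-shift₂ (suc k) = cong (3 +_) (sym (*-distribˡ-+ 4 2 k))

w-shift₂ : ∀ k → shift₂ (w (suc k)) ≡ w (3 + k)
w-shift₂ k = cong (2 +_) (u-shift₂ (suc k))

z-shift₂ : ∀ k → shift₂ (z (suc k)) ≡ z (3 + k)
z-shift₂ k = cong (2 +_) (v-shift₂ (suc k))

relabel-stepEdges : ∀ k → map relabel (stepEdges k) ≡ stepEdges (2 + k)
relabel-stepEdges k =
  cong (λ (u₀ , v₀ , u₁ , v₁ , w₁ , z₁) → (u₀ , u₁) ∷ (v₀ , v₁) ∷ (u₁ , v₁) ∷ (w₁ , u₁) ∷ (v₁ , z₁) ∷ [])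
    (cong₂ _,_ (u-shift₂ k) (cong₂ _,_ (v-shift₂ k) (cong₂ _,_ (u-shift₂ (suc k))
      (cong₂ _,_ (v-shift₂ (suc k)) (cong₂ _,_ (w-shift₂ k) (z-shift₂ k))))))

relabel-capEdges : ∀ t → map relabel (capEdges t) ≡ capEdges (suc t)
relabel-capEdges t = trans
  (cong₂ (λ cw cz → cw ∷ cz ∷ [])
    (cong₂ _,_ (w-shift₂ (2 * t)) (w-shift₂ (1 + 2 * t)))
    (cong₂ _,_ (z-shift₂ (2 * t)) (z-shift₂ (1 + 2 * t))))
  (cong (λ j → (w (1 + j) , w (2 + j)) ∷ (z (1 + j) , z (2 + j)) ∷ []) (sym (*-suc 2 t)))

relabel-concatMap : ∀ {f : ℕ → List Edge} {s : ℕ → ℕ} → (∀ k → map relabel (f k) ≡ f (s k)) →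
  ∀ g n → map relabel (concatMap f (applyUpTo g n)) ≡ concatMap f (applyUpTo (s ∘ g) n)
relabel-concatMap {f} {s} relabel-f g n = begin
  map relabel (concatMap f (applyUpTo g n))    ≡⟨ map-concatMap relabel f (applyUpTo g n) ⟩
  concatMap (map relabel ∘ f) (applyUpTo g n)  ≡⟨ concatMap-cong relabel-f (applyUpTo g n) ⟩
  concatMap (f ∘ s) (applyUpTo g n)            ≡⟨ sym (concatMap-map f s (applyUpTo g n)) ⟩
  concatMap f (map s (applyUpTo g n))          ≡⟨ cong (concatMap f) (map-applyUpTo g s n) ⟩
  concatMap f (applyUpTo (s ∘ g) n)            ∎
  where open ≡-Reasoning

GnSteps GnCaps : ℕ → List Edge
GnSteps m = concatMap stepEdges (upTo (2 * m))
GnCaps  m = concatMap capEdges (upTo m)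

Gn-tail-shift : ∀ m → GnSteps (2 + m) ++ GnCaps (2 + m) ≡
  stepEdges 0 ++ stepEdges 1 ++ map relabel (GnSteps (suc m)) ++ capEdges 0 ++ map relabel (GnCaps (suc m))
Gn-tail-shift m = begin
  concatMap stepEdges (upTo (2 * (2 + m))) ++ GnCaps (2 + m)
    ≡⟨ cong (λ n → concatMap stepEdges (upTo n) ++ GnCaps (2 + m)) (*-suc 2 (suc m)) ⟩
  stepEdges 0 ++ stepEdges 1 ++ concatMap stepEdges (applyUpTo (2 +_) (2 * suc m)) ++
    capEdges 0 ++ concatMap capEdges (applyUpTo suc (suc m))
    ≡⟨ sym (cong₂ (λ A B → stepEdges 0 ++ stepEdges 1 ++ A ++ capEdges 0 ++ B)
                  (relabel-concatMap {stepEdges} {2 +_} relabel-stepEdges id (2 * suc m))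
                  (relabel-concatMap {capEdges} {suc} relabel-capEdges id (suc m))) ⟩
  stepEdges 0 ++ stepEdges 1 ++ map relabel (GnSteps (suc m)) ++ capEdges 0 ++ map relabel (GnCaps (suc m)) ∎
  where open ≡-Reasoning

AfAvoiding-cong : ∀ {V V' e L L'} → V ≡ V' → L ≡ L' →
  AfAvoiding (record { V = V ; edges = e ∷ L }) fzero ≗ AfAvoiding (record { V = V' ; edges = e ∷ L' }) fzero
AfAvoiding-cong refl refl k = refl

x*-cong : ∀ {p q} → p ≗ q → x* p ≗ x* q
x*-cong p≗q zero    = refl
x*-cong p≗q (suc k) = p≗q k

-- For n = 1 the copy of G_{n-1} is the single edge u₂v₂, whose anti-forcing polynomial is that of G₀.
Af-K₂≗Af-G₀ : Af (Block.small 0 [] []) ≗ Af (Gn 0)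
Af-K₂≗Af-G₀ 0             = refl
Af-K₂≗Af-G₀ 1             = refl
Af-K₂≗Af-G₀ (suc (suc k)) = refl

small≡Gn : ∀ m → Block.small (8 * suc m) (GnSteps (suc m)) (GnCaps (suc m)) ≡ Gn (suc m)
small≡Gn m = refl

x*Af-cong : ∀ {G G'} → G ≡ G' → x* (Af G) ≗ x* (Af G')
x*Af-cong refl k = refl

lemma4p5 : (m : ℕ) → (k : ℕ) → AfBar0 m k ≡ x* (Af (Gn m)) k
lemma4p5 zero    k = begin
  AfBar0 0 k                              ≡⟨ AfBar0≡AfAvoiding 0 k ⟩
  AfAvoiding (Block.big 0 [] []) fzero k  ≡⟨ Block.AfAvoiding-big 0 [] [] k ⟩
  x* (Af (Block.small 0 [] [])) k         ≡⟨ x*-cong Af-K₂≗Af-G₀ k ⟩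
  x* (Af (Gn 0)) k                        ∎
  where open ≡-Reasoning
lemma4p5 (suc m) k = begin
  AfBar0 (suc m) k
    ≡⟨ AfBar0≡AfAvoiding (suc m) k ⟩
  AfAvoiding (Gn (2 + m)) fzero k
    ≡⟨ AfAvoiding-cong (cong (2 +_) (*-suc 8 (suc m))) (Gn-tail-shift m) k ⟩
  AfAvoiding (Block.big (8 * suc m) (GnSteps (suc m)) (GnCaps (suc m))) fzero k
    ≡⟨ Block.AfAvoiding-big (8 * suc m) (GnSteps (suc m)) (GnCaps (suc m)) k ⟩
  x* (Af (Block.small (8 * suc m) (GnSteps (suc m)) (GnCaps (suc m)))) k
    ≡⟨ x*Af-cong (small≡Gn m) k ⟩
  x* (Af (Gn (suc m))) k ∎
  where open ≡-Reasoning
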